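{- Consider a run of the Gram-Schmidt walk on input $v_1,\dots,v_n\in\mathbb{R}^m$ (with $\|v_i\|_2\le1$) and $x_0\in[-1,1]^n$, with $T$ executed time steps. Let $p\le q$ be two time steps in $[T]$ belonging to the same phase, i.e. $n(t)=n(p)$ for all $t\in[p,q]$. Then $\left|\sum_{t=p}^{q}\delta_t\right|\le 2$.
   Context: The Gram-Schmidt walk: Input vectors $v_1,\dots,v_n\in\mathbb{R}^m$ with $\|v_i\|_2\le 1$ and $x_0\in[-1,1]^n$. For $t=1,2,\dots$: let $A_t=\{i\in[n]:|x_{t-1}(i)|<1\}$; if $A_t=\emptyset$ stop and output $x_{t-1}$. Otherwise let the pivot be $n(t)=\max A_t$, let $V_t=\mathrm{span}\{v_i: i\in A_t, i\ne n(t)\}$, and let $v^\perp(t)$ be the orthogonal projection of $v_{n(t)}$ onto $V_t^\perp$. Choose $u_t\in\mathbb{R}^n$ with $u_t(i)=0$ for $i\notin A_t$, $u_t(n(t))=1$, and $u_t(i)$ for $i\in A_t\setminus\{n(t)\}$ chosen so that $v^\perp(t)=v_{n(t)}+\sum_{i\in A_t\setminus\{n(t)\}}u_t(i)v_i$. Let $\delta_t^-<0<\delta_t^+$ be the unique negative and positive solutions of $\max_{i\in A_t}|x_{t-1}(i)+\delta u_t(i)|=1$. Set $x_t=x_{t-1}+\delta_t u_t$, where $\delta_t=\delta_t^-$ with probability $\delta_t^+/(\delta_t^+-\delta_t^-)$ and $\delta_t=\delta_t^+$ otherwise. A phase is a maximal sequence of consecutive time steps with the same pivot $n(t)$. -}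

module Defs where

open import Level using (Level; _⊔_) renaming (suc to lsuc)
open import Algebra.Bundles using (CommutativeRing)
open import Relation.Binary.Structures using (IsTotalOrder)
open import Relation.Binary.PropositionalEquality using (_≡_)
open import Data.Nat as ℕ using (ℕ; zero; suc)
open import Data.Fin as Fin using (Fin; toℕ)
open import Data.Product using (_×_; ∃; ∃₂)
open import Data.Sum using (_⊎_)
open import Relation.Nullary using (¬_)

-- An ordered field (the real numbers are the intended instance).
-- The standard library has no reals and no ordered-field bundle, so we
-- state the lemma for an arbitrary ordered field.
record OrderedField (c ℓ₁ ℓ₂ : Level) : Set (lsuc (c ⊔ ℓ₁ ⊔ ℓ₂)) where
  field
    commutativeRing : CommutativeRing c ℓ₁
  open CommutativeRing commutativeRing public
  infix 4 _≤_ _<_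
  field
    _≤_           : Carrier → Carrier → Set ℓ₂
    ≤-isTotalOrder : IsTotalOrder _≈_ _≤_
    +-monoˡ-≤     : ∀ {a b} c → a ≤ b → (a + c) ≤ (b + c)
    *-nonneg      : ∀ {a b} → 0# ≤ a → 0# ≤ b → 0# ≤ (a * b)
    0≉1           : ¬ (0# ≈ 1#)
    inverse       : ∀ a → ¬ (a ≈ 0#) → ∃ λ b → (a * b) ≈ 1#

  _<_ : Carrier → Carrier → Set (ℓ₁ ⊔ ℓ₂)
  a < b = (a ≤ b) × ¬ (a ≈ b)

module GSW {c ℓ₁ ℓ₂ : Level} (F : OrderedField c ℓ₁ ℓ₂) where
  open OrderedField F hiding (zero)

  sumFin : ∀ {k} → (Fin k → Carrier) → Carrier
  sumFin {zero}  f = 0#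
  sumFin {suc k} f = f Fin.zero + sumFin (λ i → f (Fin.suc i))

  sumℕ : ℕ → (ℕ → Carrier) → Carrier
  sumℕ zero    f = 0#
  sumℕ (suc k) f = f zero + sumℕ k (λ t → f (suc t))

  sumRange : ℕ → ℕ → (ℕ → Carrier) → Carrier
  sumRange p q f = sumℕ (suc q ℕ.∸ p) (λ k → f (p ℕ.+ k))

  dot : ∀ {m} → (Fin m → Carrier) → (Fin m → Carrier) → Carrier
  dot a b = sumFin (λ j → a j * b j)

  AbsLe1 : Carrier → Set ℓ₂
  AbsLe1 a = (- 1# ≤ a) × (a ≤ 1#)

  AbsLt1 : Carrier → Set (ℓ₁ ⊔ ℓ₂)
  AbsLt1 a = (- 1# < a) × (a < 1#)

  AbsEq1 : Carrier → Set ℓ₁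
  AbsEq1 a = (a ≈ 1#) ⊎ (a ≈ - 1#)

  AbsLe2 : Carrier → Set ℓ₂
  AbsLe2 a = (- (1# + 1#) ≤ a) × (a ≤ 1# + 1#)

  -- i ∈ A_t  (w.r.t. the current point x = x_{t-1})
  Active : ∀ {n} → (Fin n → Carrier) → Fin n → Set (ℓ₁ ⊔ ℓ₂)
  Active x i = AbsLt1 (x i)

  IsPivot : ∀ {n} → (Fin n → Carrier) → Fin n → Set (ℓ₁ ⊔ ℓ₂)
  IsPivot x piv = Active x piv × (∀ i → Active x i → toℕ i ℕ.≤ toℕ piv)

  comb : ∀ {n m} → (Fin n → Fin m → Carrier) → (Fin n → Carrier) → Fin m → Carrier
  comb v u j = sumFin (λ i → u i * v i j)

  -- u is a valid update direction: supported on A_t, u(piv) = 1, and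
  -- v_piv + Σ_{i∈A_t∖{piv}} u(i) v_i (= Σ_i u(i) v_i) is orthogonal to
  -- V_t = span{v_i : i ∈ A_t, i ≠ piv}, i.e. it is the orthogonal
  -- projection of v_piv onto V_t^⊥.
  IsUpdateDir : ∀ {n m} → (Fin n → Fin m → Carrier) → (Fin n → Carrier) →
                Fin n → (Fin n → Carrier) → Set (ℓ₁ ⊔ ℓ₂)
  IsUpdateDir v x piv u =
    (∀ i → ¬ Active x i → u i ≈ 0#) ×
    (u piv ≈ 1#) ×
    (∀ i → Active x i → ¬ (i ≡ piv) → dot (comb v u) (v i) ≈ 0#)

  IsStepSol : ∀ {n} → (Fin n → Carrier) → (Fin n → Carrier) → Carrier → Set (ℓ₁ ⊔ ℓ₂)
  IsStepSol x u d =
    (∀ i → Active x i → AbsLe1 (x i + d * u i)) ×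
    ∃ (λ i → Active x i × AbsEq1 (x i + d * u i))

  IsStep : ∀ {n m} → (Fin n → Fin m → Carrier) → (Fin n → Carrier) → Fin n →
           (Fin n → Carrier) → Carrier → (Fin n → Carrier) → Set (c ⊔ ℓ₁ ⊔ ℓ₂)
  IsStep v x piv u d x′ =
    IsPivot x piv × IsUpdateDir v x piv u ×
    ∃₂ (λ dm dp → (dm < 0#) × (0# < dp) × IsStepSol x u dm × IsStepSol x u dp ×
                  ((d ≈ dm) ⊎ (d ≈ dp)) ×
                  (∀ i → x′ i ≈ x i + d * u i))

  -- A (realisation of a) run of the Gram–Schmidt walk with exactly T
  -- executed time steps: x t = x_t, piv t = n(t), u t = u_t, δ t = δ_t.
  IsRun : ∀ {n m} → (Fin n → Fin m → Carrier) → ℕ → (ℕ → Fin n → Carrier) →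
          (ℕ → Fin n) → (ℕ → Fin n → Carrier) → (ℕ → Carrier) → Set (c ⊔ ℓ₁ ⊔ ℓ₂)
  IsRun v T x piv u δ =
    (∀ i → dot (v i) (v i) ≤ 1#) ×
    (∀ i → AbsLe1 (x 0 i)) ×
    (∀ s → s ℕ.< T → IsStep v (x s) (piv (suc s)) (u (suc s)) (δ (suc s)) (x (suc s))) ×
    (∀ i → ¬ Active (x T) i)

module Submission where

-- Throughout the phase the pivot a = n(p) is fixed, and every update
-- direction satisfies u_t(a) = 1, so x_t(a) = x_{t-1}(a) + δ_t.  Summing
-- over the phase telescopes:
--     Σ_{t=p}^{q} δ_t = x_q(a) − x_{p-1}(a).
-- Both endpoints lie in [−1, 1]: a is active (|x_{p-1}(a)| < 1) before
-- step p, and a step never pushes an active coordinate out of [−1, 1].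
-- A difference of two numbers in [−1, 1] lies in [−2, 2].

open import Defs
open import Data.Nat using (ℕ; _≤_)
open import Data.Fin using (Fin)
open import Relation.Binary.PropositionalEquality using (_≡_)
open GSW

open import Data.Nat using (zero; suc; _∸_; _<_; s≤s; z<s)
import Data.Nat as ℕ
import Data.Nat.Properties as ℕ
open import Data.Product using (_,_)
open import Data.Sum using (inj₁; inj₂)
open import Relation.Binary.Bundles using (Poset)
open import Relation.Binary.Structures using (IsTotalOrder)
import Relation.Binary.PropositionalEquality as P
import Algebra.Properties.Ring as RingProperties
import Relation.Binary.Reasoning.PartialOrder as ≤-Reasoning
import Relation.Binary.Reasoning.Setoid as ≈-Reasoning

module OrderedFieldProperties {c ℓ₁ ℓ₂} (F : OrderedField c ℓ₁ ℓ₂) where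
  open OrderedField F hiding (zero; _<_) renaming (_≤_ to _≤F_)
  open RingProperties ring using (-‿involutive; -‿+-comm; //-rightDividesʳ; xyx⁻¹≈y)
  open IsTotalOrder ≤-isTotalOrder using (isPartialOrder; ≤-respˡ-≈; ≤-respʳ-≈)

  poset : Poset c ℓ₁ ℓ₂
  poset = record { isPartialOrder = isPartialOrder }

  open ≤-Reasoning poset

  +-mono-≤ : ∀ {a b c d} → a ≤F b → c ≤F d → a + c ≤F b + d
  +-mono-≤ {a} {b} {c} {d} a≤b c≤d = begin
    a + c  ≤⟨ +-monoˡ-≤ c a≤b ⟩
    b + c  ≈⟨ +-comm b c ⟩
    c + b  ≤⟨ +-monoˡ-≤ b c≤d ⟩
    d + b  ≈⟨ +-comm d b ⟩
    b + d  ∎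

  -- Negation reverses the order: add −a and then −b to both sides.
  neg-antitone : ∀ {a b} → a ≤F b → - b ≤F - a
  neg-antitone {a} {b} a≤b = begin
    - b            ≈⟨ +-identityˡ (- b) ⟨
    0# + - b       ≈⟨ +-congʳ (-‿inverseʳ a) ⟨
    a + - a + - b  ≤⟨ +-monoˡ-≤ (- b) (+-monoˡ-≤ (- a) a≤b) ⟩
    b + - a + - b  ≈⟨ xyx⁻¹≈y b (- a) ⟩
    - a            ∎

  absLt1⇒absLe1 : ∀ {a} → AbsLt1 F a → AbsLe1 F a
  absLt1⇒absLe1 ((l , _) , (r , _)) = l , r

  absLe1-resp-≈ : ∀ {a a′} → a ≈ a′ → AbsLe1 F a → AbsLe1 F a′
  absLe1-resp-≈ a≈a′ (l , r) = ≤-respʳ-≈ a≈a′ l , ≤-respˡ-≈ a≈a′ r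

  difference-bound : ∀ {S b c} → AbsLe1 F b → AbsLe1 F c → S + b ≈ c → AbsLe2 F S
  difference-bound {S} {b} {c} (lb , ub) (lc , uc) S+b≈c = lower , upper
    where
    S≈c-b : S ≈ c + - b
    S≈c-b = trans (sym (//-rightDividesʳ b S)) (+-congʳ S+b≈c)

    lower : - (1# + 1#) ≤F S
    lower = begin
      - (1# + 1#)   ≈⟨ -‿+-comm 1# 1# ⟨
      - 1# + - 1#   ≤⟨ +-mono-≤ lc (neg-antitone ub) ⟩
      c + - b       ≈⟨ S≈c-b ⟨
      S             ∎

    upper : S ≤F 1# + 1#
    upper = begin
      S             ≈⟨ S≈c-b ⟩
      c + - b       ≤⟨ +-mono-≤ uc (neg-antitone lb) ⟩
      1# + - (- 1#) ≈⟨ +-congˡ (-‿involutive 1#) ⟩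
      1# + 1#       ∎

module Telescoping {c ℓ₁ ℓ₂} (F : OrderedField c ℓ₁ ℓ₂) where
  open OrderedField F hiding (zero; _≤_; _<_)
  open ≈-Reasoning setoid

  telescope : ∀ j (f y : ℕ → Carrier) → (∀ k → k < j → y (suc k) ≈ y k + f k) →
              sumℕ F j f + y 0 ≈ y j
  telescope zero    f y step = +-identityˡ (y 0)
  telescope (suc j) f y step = begin
    f 0 + sumℕ F j (f ∘suc) + y 0  ≈⟨ +-assoc (f 0) _ (y 0) ⟩
    f 0 + (sumℕ F j (f ∘suc) + y 0) ≈⟨ +-comm (f 0) _ ⟩
    sumℕ F j (f ∘suc) + y 0 + f 0  ≈⟨ +-assoc _ (y 0) (f 0) ⟩
    sumℕ F j (f ∘suc) + (y 0 + f 0) ≈⟨ +-congˡ (step 0 z<s) ⟨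
    sumℕ F j (f ∘suc) + y 1        ≈⟨ telescope j (f ∘suc) (y ∘suc) (λ k k<j → step (suc k) (s≤s k<j)) ⟩
    y (suc j)                       ∎
    where
    _∘suc : (ℕ → Carrier) → ℕ → Carrier
    (g ∘suc) k = g (suc k)

  sumRange-telescope : ∀ {p′ q} (f y : ℕ → Carrier) → p′ ≤ q →
                       (∀ t → p′ ≤ t → t < q → y (suc t) ≈ y t + f (suc t)) →
                       sumRange F (suc p′) q f + y p′ ≈ y q
  sumRange-telescope {p′} {q} f y p′≤q step =
    P.subst₂ (λ i j → sumℕ F (q ∸ p′) (λ k → f (suc (p′ ℕ.+ k))) + y i ≈ y j)
      (ℕ.+-identityʳ p′) (ℕ.m+[n∸m]≡n p′≤q)
      (telescope (q ∸ p′) (λ k → f (suc (p′ ℕ.+ k))) (λ k → y (p′ ℕ.+ k)) shifted-step)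
    where
    shifted-step : ∀ k → k < q ∸ p′ → y (p′ ℕ.+ suc k) ≈ y (p′ ℕ.+ k) + f (suc (p′ ℕ.+ k))
    shifted-step k k<q∸p′ rewrite ℕ.+-suc p′ k =
      step (p′ ℕ.+ k) (ℕ.m≤m+n p′ k)
        (P.subst (p′ ℕ.+ k <_) (ℕ.m+[n∸m]≡n p′≤q) (ℕ.+-monoʳ-< p′ k<q∸p′))

module WalkStep {c ℓ₁ ℓ₂} (F : OrderedField c ℓ₁ ℓ₂) {n m : ℕ}
                (v : Fin n → Fin m → OrderedField.Carrier F) where
  open OrderedField F hiding (zero; _≤_; _<_)
  open OrderedFieldProperties F using (absLt1⇒absLe1; absLe1-resp-≈)

  -- The pivot of a step is active, so it starts the step inside [−1, 1].
  pivot-bounded-before : ∀ {x a u d x′} → IsStep F v x a u d x′ → AbsLe1 F (x a)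
  pivot-bounded-before ((a-active , _) , _) = absLt1⇒absLe1 a-active

  -- Since u(a) = 1, the pivot coordinate moves by exactly the step size.
  pivot-increment : ∀ {x a u d x′} → IsStep F v x a u d x′ → x′ a ≈ x a + d
  pivot-increment {a = a} {d = d} (_ , (_ , uₐ≈1 , _) , _ , _ , _ , _ , _ , _ , _ , update) =
    trans (update a) (+-congˡ (trans (*-congˡ uₐ≈1) (*-identityʳ d)))

  candidate-is-update : ∀ {xᵢ uᵢ d e x′ᵢ} → x′ᵢ ≈ xᵢ + d * uᵢ → d ≈ e → xᵢ + e * uᵢ ≈ x′ᵢ
  candidate-is-update update d≈e = trans (+-congˡ (*-congʳ (sym d≈e))) (sym update)

  -- Both candidate step sizes keep every active coordinate inside [−1, 1],
  -- hence so does the chosen one.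
  active-bounded-after : ∀ {x a u d x′} → IsStep F v x a u d x′ →
                         ∀ i → Active F x i → AbsLe1 F (x′ i)
  active-bounded-after
    (_ , _ , _ , _ , _ , _ , (dm-bounded , _) , (dp-bounded , _) , d-choice , update) i i-active
    with d-choice
  ... | inj₁ d≈dm = absLe1-resp-≈ (candidate-is-update (update i) d≈dm) (dm-bounded i i-active)
  ... | inj₂ d≈dp = absLe1-resp-≈ (candidate-is-update (update i) d≈dp) (dp-bounded i i-active)

  pivot-bounded-after : ∀ {x a u d x′} → IsStep F v x a u d x′ → AbsLe1 F (x′ a)
  pivot-bounded-after step@((a-active , _) , _) = active-bounded-after step _ a-active

-- Lemma 12.  With p = p′+1, q = q′+1 and a the pivot of the phase,
-- Σ_{t=p}^{q} δ_t + x_{p′}(a) = x_q(a), where |x_{p′}(a)| ≤ 1 because a is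
-- the pivot of step p and |x_q(a)| ≤ 1 by step q.
lemma12 : ∀ {c ℓ₁ ℓ₂} (F : OrderedField c ℓ₁ ℓ₂) {n m : ℕ}
    (v : Fin n → Fin m → OrderedField.Carrier F) (T : ℕ)
    (x : ℕ → Fin n → OrderedField.Carrier F) (piv : ℕ → Fin n)
    (u : ℕ → Fin n → OrderedField.Carrier F) (δ : ℕ → OrderedField.Carrier F) →
    IsRun F v T x piv u δ →
    (p q : ℕ) → 1 ≤ p → p ≤ q → q ≤ T →
    (∀ t → p ≤ t → t ≤ q → piv t ≡ piv p) →
    AbsLe2 F (sumRange F p q δ)
lemma12 F v T x piv u δ (_ , _ , steps , _) (suc p′) (suc q′) _ (s≤s p′≤q′) q≤T same-pivot =
  difference-bound (pivot-bounded-before (phase-step p′ ℕ.≤-refl (s≤s p′≤q′)))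
                   (pivot-bounded-after (phase-step q′ p′≤q′ ℕ.≤-refl))
                   (sumRange-telescope δ (λ t → x t a) (ℕ.m≤n⇒m≤1+n p′≤q′)
                     (λ t p′≤t t<q → pivot-increment (phase-step t p′≤t t<q)))
  where
  open OrderedFieldProperties F using (difference-bound)
  open Telescoping F using (sumRange-telescope)
  open WalkStep F v using (pivot-bounded-before; pivot-bounded-after; pivot-increment)

  a : Fin _
  a = piv (suc p′)

  phase-step : ∀ t → p′ ≤ t → t < suc q′ → IsStep F v (x t) a (u (suc t)) (δ (suc t)) (x (suc t))
  phase-step t p′≤t t<q =
    P.subst (λ b → IsStep F v (x t) b (u (suc t)) (δ (suc t)) (x (suc t)))
      (same-pivot (suc t) (s≤s p′≤t) t<q)
      (steps t (ℕ.≤-trans t<q q≤T))
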